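{- Multiplying two $n\times n$ matrices $A,B$ over a semiring in the MPC model with $n$ processors, each with $O(n)$ words of memory, requires $\Omega(\sqrt{n})$ communication rounds.
   Context: MPC model: there are $P$ processors, each with $M$ words of local memory; the input is distributed among the processors; computation proceeds in synchronous rounds of local computation followed by message exchange, each processor sending and receiving $O(M)$ words per round. A term is a product $a_{ix}b_{xj}$ contributing to $c_{ij}=\sum_x a_{ix}b_{xj}$; over a general semiring every one of the $n^3$ terms must be computed explicitly by some processor holding both factors, and terms contributing to different entries of $C$ cannot be combined. -}

module Defs where

open import Data.Nat using (ℕ; suc; _≤_)
open import Data.Fin using (Fin)
open import Data.List using (List; length; map; allFin)
open import Data.Nat.ListAction using (sum)
open import Data.List.Membership.Propositional using (_∈_)
open import Data.Product using (∃-syntax; _×_)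
open import Data.Sum using (_⊎_)
open import Relation.Nullary using (¬_)

-- Words that can be held by a processor, for n×n matrix multiplication
-- over a general semiring (abstracted: only which quantity a word stores
-- matters, since terms must be formed explicitly and partial sums of
-- different entries of C cannot be combined).
data Word (n : ℕ) : Set where
  a : Fin n → Fin n → Word n
  b : Fin n → Fin n → Word n
  c : Fin n → Fin n → Word n   -- c i j : a word holding a partial sum of c_{ij}

Σlen : ∀ {n} → (Fin n → List (Word n)) → ℕ
Σlen {n} f = sum (map (λ q → length (f q)) (allFin n))

-- Round t (t = 0,1,...): processor p starts with memory  mem t p,
-- performs local computation ending with memory  post t p,
-- then sends  msg t p q  to processor q; the memory at the start of
-- round t+1 consists of received words (and, generously, words kept
-- locally from  post t p).
record Execution (n M : ℕ) : Set where
  field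
    mem  : ℕ → Fin n → List (Word n)
    post : ℕ → Fin n → List (Word n)
    msg  : ℕ → Fin n → Fin n → List (Word n)
    mem-bound  : ∀ t p → length (mem t p) ≤ M
    post-bound : ∀ t p → length (post t p) ≤ M
    send-bound : ∀ t p → Σlen (msg t p) ≤ M
    recv-bound : ∀ t q → Σlen (λ p → msg t p q) ≤ M
    input-a : ∀ i x → ∃[ p ] a i x ∈ mem 0 p
    input-b : ∀ x j → ∃[ p ] b x j ∈ mem 0 p
    no-initial-c : ∀ p i j → ¬ (c i j ∈ mem 0 p)
    local-a : ∀ t p i x → a i x ∈ post t p → a i x ∈ mem t p
    local-b : ∀ t p x j → b x j ∈ post t p → b x j ∈ mem t p
    send-from : ∀ t p q w → w ∈ msg t p q → w ∈ post t p
    next-from : ∀ t q w → w ∈ mem (suc t) q → w ∈ post t q ⊎ ∃[ p ] w ∈ msg t p q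

  -- processor p computes the term a_{ix} b_{xj} in round t: it holds both
  -- factors and the term is accumulated into a partial sum of c_{ij} it holds.
  Computes : ℕ → Fin n → Fin n → Fin n → Fin n → Set
  Computes t p i x j = a i x ∈ mem t p × b x j ∈ mem t p × c i j ∈ post t p

open Execution public

MultipliesIn : ∀ {n M} → Execution n M → ℕ → Set
MultipliesIn {n} E R =
  ∀ (i x j : Fin n) → ∃[ t ] (t Data.Nat.< R × ∃[ p ] Computes E t p i x j)

-- Fix a processor and a round, and let α_x and β_x be the numbers of entries of
-- column x of A and of row x of B that it holds, and γ the number of entries of C
-- it accumulates into.  It computes at most min(α_x β_x, γ) terms a_{ix} b_{xj}
-- with middle index x.  For a threshold s this is at most s(α_x + β_x) when
-- min(α_x, β_x) ≤ s, and at most α_x γ / s otherwise; summing over x, with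
-- ∑ α_x, ∑ β_x, γ ≤ M, one processor computes at most 2sM + M²/s terms per round.
-- So n processors in R rounds compute at most Rn(2sM + M²/s) of the n³ terms,
-- and with M = kn, s = 2k²R this forces n ≤ 8k³R².
module Submission where

open import Defs
open import Data.Nat using (ℕ; _≤_; _*_)
open import Data.Product using (∃-syntax; _×_; _,_; proj₁; proj₂)

open import Data.Bool.Base using (true; false; if_then_else_)
open import Data.Empty using (⊥-elim)
open import Data.Fin.Base using (Fin; zero; suc; toℕ; fromℕ<)
import Data.Fin.Properties as Fin
open import Data.Fin.Properties using (toℕ-fromℕ<)
open import Data.List.Base using (List; []; _∷_; length)
import Data.List.Membership.DecPropositional as DecMembership
open import Data.List.Membership.Propositional.Properties using (∈-length)
open import Data.Nat.Base using (_+_; zero; suc; NonZero; z≤n; s≤s)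
open import Data.Nat.Properties
open import Data.Nat.Tactic.RingSolver using (solve-∀)
open import Data.Product.Properties using (≡-dec)
open import Function.Base using (_∘_)
open import Function.Bundles using (mk↣)
open import Relation.Binary.Definitions using (DecidableEquality)
open import Relation.Binary.PropositionalEquality
open import Relation.Nullary.Decidable using (Dec; does; _because_; _⊎-dec_; yes; no; dec-true; via-injection)

open import Algebra.Properties.Semiring.Sum +-*-semiring
  using (sum-syntax; sum-cong-≗; sum-replicate-zero; ∑-comm; ∑-distrib-+; *-distribˡ-sum; *-distribʳ-sum)

-- Going through `does` makes ⟦ w ∈? y ∷ L ⟧ reduce to ⟦ (w ≟ y) ⊎-dec (w ∈? L) ⟧.
⟦_⟧ : {P : Set} → Dec P → ℕ
⟦ P? ⟧ = if does P? then 1 else 0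

⟦⟧≤1 : {P : Set} (P? : Dec P) → ⟦ P? ⟧ ≤ 1
⟦⟧≤1 (true  because _) = ≤-refl
⟦⟧≤1 (false because _) = z≤n

⟦⟧≡1 : {P : Set} (P? : Dec P) → P → ⟦ P? ⟧ ≡ 1
⟦⟧≡1 P? p rewrite dec-true P? p = refl

⟦⊎-dec⟧≤ : {P Q : Set} (P? : Dec P) (Q? : Dec Q) → ⟦ P? ⊎-dec Q? ⟧ ≤ ⟦ P? ⟧ + ⟦ Q? ⟧
⟦⊎-dec⟧≤ (true  because _) Q? = s≤s z≤n
⟦⊎-dec⟧≤ (false because _) Q? = ≤-refl

∑-mono-≤ : ∀ {n} {f g : Fin n → ℕ} → (∀ i → f i ≤ g i) → ∑[ i < n ] f i ≤ ∑[ i < n ] g i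
∑-mono-≤ {zero}  f≤g = z≤n
∑-mono-≤ {suc n} f≤g = +-mono-≤ (f≤g zero) (∑-mono-≤ (f≤g ∘ suc))

term≤∑ : ∀ {n} (f : Fin n → ℕ) i → f i ≤ ∑[ j < n ] f j
term≤∑ f zero    = m≤m+n _ _
term≤∑ f (suc i) = ≤-trans (term≤∑ (f ∘ suc) i) (m≤n+m _ _)

∑-const : ∀ n u → ∑[ i < n ] u ≡ n * u
∑-const zero    u = refl
∑-const (suc n) u = cong (u +_) (∑-const n u)

∑-δ : ∀ {n} (i : Fin n) → ∑[ j < n ] ⟦ i Fin.≟ j ⟧ ≡ 1
∑-δ {suc n} zero    = cong suc (sum-replicate-zero n)
∑-δ {suc n} (suc i) = ∑-δ i

∑∑-zero : ∀ m n → ∑[ i < m ] ∑[ j < n ] 0 ≡ 0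
∑∑-zero m n = trans (sum-cong-≗ {m} {λ _ → ∑[ j < n ] 0} (λ _ → sum-replicate-zero n)) (sum-replicate-zero m)

∑∑-distrib-+ : ∀ {m n} (f g : Fin m → Fin n → ℕ) →
  ∑[ i < m ] ∑[ j < n ] (f i j + g i j) ≡ ∑[ i < m ] ∑[ j < n ] f i j + ∑[ i < m ] ∑[ j < n ] g i j
∑∑-distrib-+ {m} {n} f g = trans (sum-cong-≗ (λ i → ∑-distrib-+ (f i) (g i)))
                                 (∑-distrib-+ (λ i → ∑[ j < n ] f i j) (λ i → ∑[ j < n ] g i j))

∑-swap³ : ∀ {k l m r} (f : Fin k → Fin l → Fin m → Fin r → ℕ) →
  ∑[ x < k ] ∑[ i < l ] ∑[ j < m ] ∑[ t < r ] f x i j t ≡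
  ∑[ t < r ] ∑[ x < k ] ∑[ i < l ] ∑[ j < m ] f x i j t
∑-swap³ {k} {l} {m} {r} f = begin
  ∑[ x < k ] ∑[ i < l ] ∑[ j < m ] ∑[ t < r ] f x i j t
    ≡⟨ sum-cong-≗ (λ x → sum-cong-≗ (λ i → ∑-comm (f x i))) ⟩
  ∑[ x < k ] ∑[ i < l ] ∑[ t < r ] ∑[ j < m ] f x i j t
    ≡⟨ sum-cong-≗ (λ x → ∑-comm (λ i t → ∑[ j < m ] f x i j t)) ⟩
  ∑[ x < k ] ∑[ t < r ] ∑[ i < l ] ∑[ j < m ] f x i j t
    ≡⟨ ∑-comm (λ x t → ∑[ i < l ] ∑[ j < m ] f x i j t) ⟩
  ∑[ t < r ] ∑[ x < k ] ∑[ i < l ] ∑[ j < m ] f x i j t ∎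
  where open ≡-Reasoning

module _ {A : Set} (_≟_ : DecidableEquality A) where
  open DecMembership _≟_ using (_∈?_)

  module _ {m n} (g : Fin m → Fin n → A) (index : A → Fin m × Fin n)
           (index∘g : ∀ i x → index (g i x) ≡ (i , x)) where

    ⟦≟⟧≤δ : ∀ y i x → ⟦ g i x ≟ y ⟧ ≤ ⟦ proj₁ (index y) Fin.≟ i ⟧ * ⟦ proj₂ (index y) Fin.≟ x ⟧
    ⟦≟⟧≤δ y i x with g i x ≟ y
    ... | no _     = z≤n
    ... | yes refl rewrite index∘g i x | ⟦⟧≡1 (i Fin.≟ i) refl | ⟦⟧≡1 (x Fin.≟ x) refl = ≤-refl

    preimages≤1 : ∀ y → ∑[ i < m ] ∑[ x < n ] ⟦ g i x ≟ y ⟧ ≤ 1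
    preimages≤1 y = begin
      ∑[ i < m ] ∑[ x < n ] ⟦ g i x ≟ y ⟧  ≤⟨ ∑-mono-≤ (λ i → ∑-mono-≤ (⟦≟⟧≤δ y i)) ⟩
      ∑[ i < m ] ∑[ x < n ] (δ₁ i * δ₂ x)  ≡⟨ sum-cong-≗ (λ i → *-distribˡ-sum (δ₁ i) δ₂) ⟨
      ∑[ i < m ] (δ₁ i * ∑[ x < n ] δ₂ x)  ≡⟨ *-distribʳ-sum (∑[ x < n ] δ₂ x) δ₁ ⟨
      ∑[ i < m ] δ₁ i * ∑[ x < n ] δ₂ x    ≡⟨ cong₂ _*_ (∑-δ (proj₁ (index y))) (∑-δ (proj₂ (index y))) ⟩
      1                                    ∎
      where
      open ≤-Reasoning
      δ₁ = λ i → ⟦ proj₁ (index y) Fin.≟ i ⟧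
      δ₂ = λ x → ⟦ proj₂ (index y) Fin.≟ x ⟧

    ∑∑-∈?-≤-length : ∀ L → ∑[ i < m ] ∑[ x < n ] ⟦ g i x ∈? L ⟧ ≤ length L
    ∑∑-∈?-≤-length [] = ≤-reflexive (∑∑-zero m n)
    ∑∑-∈?-≤-length (y ∷ L) = begin
      ∑[ i < m ] ∑[ x < n ] ⟦ g i x ∈? y ∷ L ⟧
        ≤⟨ ∑-mono-≤ (λ i → ∑-mono-≤ (λ x → ⟦⊎-dec⟧≤ (g i x ≟ y) (g i x ∈? L))) ⟩
      ∑[ i < m ] ∑[ x < n ] (⟦ g i x ≟ y ⟧ + ⟦ g i x ∈? L ⟧)
        ≡⟨ ∑∑-distrib-+ (λ i x → ⟦ g i x ≟ y ⟧) (λ i x → ⟦ g i x ∈? L ⟧) ⟩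
      ∑[ i < m ] ∑[ x < n ] ⟦ g i x ≟ y ⟧ + ∑[ i < m ] ∑[ x < n ] ⟦ g i x ∈? L ⟧
        ≤⟨ +-mono-≤ (preimages≤1 y) (∑∑-∈?-≤-length L) ⟩
      suc (length L) ∎
      where open ≤-Reasoning

index : ∀ {n} → Word n → Fin n × Fin n
index (a i x) = i , x
index (b x j) = x , j
index (c i j) = i , j

kind : ∀ {n} → Word n → Fin 3
kind (a _ _) = zero
kind (b _ _) = suc zero
kind (c _ _) = suc (suc zero)

fromKindIndex : ∀ {n} → Fin 3 × Fin n × Fin n → Word n
fromKindIndex (zero , i , j)           = a i j
fromKindIndex (suc zero , i , j)       = b i j
fromKindIndex (suc (suc zero) , i , j) = c i j

fromKindIndex-inverse : ∀ {n} (w : Word n) → fromKindIndex (kind w , index w) ≡ w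
fromKindIndex-inverse (a _ _) = refl
fromKindIndex-inverse (b _ _) = refl
fromKindIndex-inverse (c _ _) = refl

_≟ʷ_ : ∀ {n} → DecidableEquality (Word n)
_≟ʷ_ = via-injection (mk↣ kindIndex-injective) (≡-dec Fin._≟_ (≡-dec Fin._≟_ Fin._≟_))
  where
  kindIndex-injective : ∀ {n} {w w′ : Word n} → (kind w , index w) ≡ (kind w′ , index w′) → w ≡ w′
  kindIndex-injective {w = w} {w′} eq =
    trans (sym (fromKindIndex-inverse w)) (trans (cong fromKindIndex eq) (fromKindIndex-inverse w′))

s*t≤s*s*[α+β]+α*γ : ∀ s t α β γ → t ≤ α * β → t ≤ γ → s * t ≤ s * s * (α + β) + α * γ
s*t≤s*s*[α+β]+α*γ s t α β γ t≤αβ t≤γ with α ≤? s | β ≤? s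
... | yes α≤s | _ = begin
  s * t             ≤⟨ *-monoʳ-≤ s (≤-trans t≤αβ (*-monoˡ-≤ β α≤s)) ⟩
  s * (s * β)       ≡⟨ *-assoc s s β ⟨
  s * s * β         ≤⟨ *-monoʳ-≤ (s * s) (m≤n+m β α) ⟩
  s * s * (α + β)   ≤⟨ m≤m+n _ _ ⟩
  s * s * (α + β) + α * γ ∎
  where open ≤-Reasoning
... | no _ | yes β≤s = begin
  s * t             ≤⟨ *-monoʳ-≤ s (≤-trans t≤αβ (*-monoʳ-≤ α β≤s)) ⟩
  s * (α * s)       ≡⟨ cong (s *_) (*-comm α s) ⟩
  s * (s * α)       ≡⟨ *-assoc s s α ⟨
  s * s * α         ≤⟨ *-monoʳ-≤ (s * s) (m≤m+n α β) ⟩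
  s * s * (α + β)   ≤⟨ m≤m+n _ _ ⟩
  s * s * (α + β) + α * γ ∎
  where open ≤-Reasoning
... | no α≰s | no _ = ≤-trans (*-mono-≤ (<⇒≤ (≰⇒> α≰s)) t≤γ) (m≤n+m _ _)

module _ {n : ℕ} (held accumulated : List (Word n)) where
  open DecMembership (_≟ʷ_ {n}) using (_∈?_)

  canCompute : Fin n → Fin n → Fin n → ℕ
  canCompute i x j = ⟦ a i x ∈? held ⟧ * ⟦ b x j ∈? held ⟧ * ⟦ c i j ∈? accumulated ⟧

  termsThrough : Fin n → ℕ
  termsThrough x = ∑[ i < n ] ∑[ j < n ] canCompute i x j

  termCount : ℕ
  termCount = ∑[ x < n ] termsThrough x

  columnOfA rowOfB : Fin n → ℕ
  columnOfA x = ∑[ i < n ] ⟦ a i x ∈? held ⟧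
  rowOfB x = ∑[ j < n ] ⟦ b x j ∈? held ⟧

  entriesOfC : ℕ
  entriesOfC = ∑[ i < n ] ∑[ j < n ] ⟦ c i j ∈? accumulated ⟧

  termsThrough≤columnOfA*rowOfB : ∀ x → termsThrough x ≤ columnOfA x * rowOfB x
  termsThrough≤columnOfA*rowOfB x = begin
    ∑[ i < n ] ∑[ j < n ] canCompute i x j
      ≤⟨ ∑-mono-≤ (λ i → ∑-mono-≤ (λ j → *-monoʳ-≤ (Aᵢ i * Bⱼ j) (⟦⟧≤1 (c i j ∈? accumulated)))) ⟩
    ∑[ i < n ] ∑[ j < n ] (Aᵢ i * Bⱼ j * 1)
      ≡⟨ sum-cong-≗ (λ i → sum-cong-≗ (λ j → *-identityʳ (Aᵢ i * Bⱼ j))) ⟩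
    ∑[ i < n ] ∑[ j < n ] (Aᵢ i * Bⱼ j)
      ≡⟨ sum-cong-≗ (λ i → *-distribˡ-sum (Aᵢ i) Bⱼ) ⟨
    ∑[ i < n ] (Aᵢ i * rowOfB x)
      ≡⟨ *-distribʳ-sum (rowOfB x) Aᵢ ⟨
    columnOfA x * rowOfB x ∎
    where
    open ≤-Reasoning
    Aᵢ = λ i → ⟦ a i x ∈? held ⟧
    Bⱼ = λ j → ⟦ b x j ∈? held ⟧

  termsThrough≤entriesOfC : ∀ x → termsThrough x ≤ entriesOfC
  termsThrough≤entriesOfC x = ∑-mono-≤ (λ i → ∑-mono-≤ (λ j → let Cᵢⱼ = ⟦ c i j ∈? accumulated ⟧ in
    ≤-trans (*-monoˡ-≤ Cᵢⱼ (*-mono-≤ (⟦⟧≤1 (a i x ∈? held)) (⟦⟧≤1 (b x j ∈? held))))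
            (≤-reflexive (*-identityˡ Cᵢⱼ))))

  ∑columnOfA≤length : ∑[ x < n ] columnOfA x ≤ length held
  ∑columnOfA≤length = ≤-trans (≤-reflexive (∑-comm (λ x i → ⟦ a i x ∈? held ⟧)))
                              (∑∑-∈?-≤-length _≟ʷ_ a index (λ _ _ → refl) held)

  ∑rowOfB≤length : ∑[ x < n ] rowOfB x ≤ length held
  ∑rowOfB≤length = ∑∑-∈?-≤-length _≟ʷ_ b index (λ _ _ → refl) held

  entriesOfC≤length : entriesOfC ≤ length accumulated
  entriesOfC≤length = ∑∑-∈?-≤-length _≟ʷ_ c index (λ _ _ → refl) accumulated

  s*termCount-bound : ∀ s → s * termCount ≤ s * s * (length held + length held) + length held * length accumulated
  s*termCount-bound s = begin
    s * termCount
      ≡⟨ *-distribˡ-sum s termsThrough ⟩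
    ∑[ x < n ] (s * termsThrough x)
      ≤⟨ ∑-mono-≤ (λ x → s*t≤s*s*[α+β]+α*γ s (termsThrough x) (columnOfA x) (rowOfB x) entriesOfC
           (termsThrough≤columnOfA*rowOfB x) (termsThrough≤entriesOfC x)) ⟩
    ∑[ x < n ] (s * s * (columnOfA x + rowOfB x) + columnOfA x * entriesOfC)
      ≡⟨ ∑-distrib-+ (λ x → s * s * (columnOfA x + rowOfB x)) (λ x → columnOfA x * entriesOfC) ⟩
    ∑[ x < n ] (s * s * (columnOfA x + rowOfB x)) + ∑[ x < n ] (columnOfA x * entriesOfC)
      ≡⟨ cong₂ _+_ (trans (sym (*-distribˡ-sum (s * s) (λ x → columnOfA x + rowOfB x)))
                          (cong (s * s *_) (∑-distrib-+ columnOfA rowOfB)))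
                   (sym (*-distribʳ-sum entriesOfC columnOfA)) ⟩
    s * s * (∑[ x < n ] columnOfA x + ∑[ x < n ] rowOfB x) + ∑[ x < n ] columnOfA x * entriesOfC
      ≤⟨ +-mono-≤ (*-monoʳ-≤ (s * s) (+-mono-≤ ∑columnOfA≤length ∑rowOfB≤length))
                  (*-mono-≤ ∑columnOfA≤length entriesOfC≤length) ⟩
    s * s * (length held + length held) + length held * length accumulated ∎
    where open ≤-Reasoning

module _ {n M : ℕ} (E : Execution n M) where
  open DecMembership (_≟ʷ_ {n}) using (_∈?_)

  canComputeIn : ℕ → Fin n → Fin n → Fin n → Fin n → ℕ
  canComputeIn t p = canCompute (mem E t p) (post E t p)

  s*termCount≤s*s*[M+M]+M*M : ∀ s t p → s * termCount (mem E t p) (post E t p) ≤ s * s * (M + M) + M * M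
  s*termCount≤s*s*[M+M]+M*M s t p =
    ≤-trans (s*termCount-bound (mem E t p) (post E t p) s)
            (+-mono-≤ (*-monoʳ-≤ (s * s) (+-mono-≤ held≤M held≤M)) (*-mono-≤ held≤M (post-bound E t p)))
    where held≤M = mem-bound E t p

  canComputeIn≡1 : ∀ {t p i x j} → Computes E t p i x j → canComputeIn t p i x j ≡ 1
  canComputeIn≡1 {t} {p} {i} {x} {j} (a∈ , b∈ , c∈)
    rewrite ⟦⟧≡1 (a i x ∈? mem E t p) a∈ | ⟦⟧≡1 (b x j ∈? mem E t p) b∈ | ⟦⟧≡1 (c i j ∈? post E t p) c∈ = refl

  module _ {R : ℕ} (multiplies : MultipliesIn E R) where

    every-term-computed : ∀ x i j → 1 ≤ ∑[ t < R ] ∑[ p < n ] canComputeIn (toℕ t) p i x j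
    every-term-computed x i j with multiplies i x j
    ... | t , t<R , p , computed = begin
      1                                                  ≡⟨ canComputeIn≡1 computed ⟨
      canComputeIn t p i x j                             ≡⟨ cong (λ u → canComputeIn u p i x j) (toℕ-fromℕ< t<R) ⟨
      canComputeIn (toℕ t′) p i x j                      ≤⟨ term≤∑ (λ q → canComputeIn (toℕ t′) q i x j) p ⟩
      ∑[ q < n ] canComputeIn (toℕ t′) q i x j           ≤⟨ term≤∑ (λ u → ∑[ q < n ] canComputeIn (toℕ u) q i x j) t′ ⟩
      ∑[ u < R ] ∑[ q < n ] canComputeIn (toℕ u) q i x j ∎
      where
      open ≤-Reasoning
      t′ = fromℕ< t<R

    s*n³≤ : ∀ s → s * (n * (n * (n * 1))) ≤ R * (n * (s * s * (M + M) + M * M))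
    s*n³≤ s = begin
      s * (n * (n * (n * 1)))
        ≡⟨ cong (s *_) n³≡∑∑∑1 ⟩
      s * ∑[ x < n ] ∑[ i < n ] ∑[ j < n ] 1
        ≤⟨ *-monoʳ-≤ s (∑-mono-≤ λ x → ∑-mono-≤ λ i → ∑-mono-≤ λ j → every-term-computed x i j) ⟩
      s * ∑[ x < n ] ∑[ i < n ] ∑[ j < n ] ∑[ t < R ] ∑[ p < n ] canComputeIn (toℕ t) p i x j
        ≡⟨ cong (s *_) (∑-swap³ {n} {n} {n} {R} (λ x i j t → ∑[ p < n ] canComputeIn (toℕ t) p i x j)) ⟩
      s * ∑[ t < R ] ∑[ x < n ] ∑[ i < n ] ∑[ j < n ] ∑[ p < n ] canComputeIn (toℕ t) p i x j
        ≡⟨ cong (s *_) (sum-cong-≗ {R} λ t → ∑-swap³ {n} {n} {n} {n} (λ x i j p → canComputeIn (toℕ t) p i x j)) ⟩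
      s * ∑[ t < R ] ∑[ p < n ] termCountIn t p
        ≡⟨ *-distribˡ-sum s (λ t → ∑[ p < n ] termCountIn t p) ⟩
      ∑[ t < R ] (s * ∑[ p < n ] termCountIn t p)
        ≡⟨ sum-cong-≗ {R} (λ t → *-distribˡ-sum s (termCountIn t)) ⟩
      ∑[ t < R ] ∑[ p < n ] (s * termCountIn t p)
        ≤⟨ ∑-mono-≤ {R} (λ t → ∑-mono-≤ {n} (λ p → s*termCount≤s*s*[M+M]+M*M s (toℕ t) p)) ⟩
      ∑[ t < R ] ∑[ p < n ] bound
        ≡⟨ trans (sum-cong-≗ {R} (λ _ → ∑-const n bound)) (∑-const R (n * bound)) ⟩
      R * (n * bound) ∎
      where
      open ≤-Reasoning
      bound = s * s * (M + M) + M * M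
      termCountIn : Fin R → Fin n → ℕ
      termCountIn t p = termCount (mem E (toℕ t) p) (post E (toℕ t) p)
      n³≡∑∑∑1 : n * (n * (n * 1)) ≡ ∑[ x < n ] ∑[ i < n ] ∑[ j < n ] 1
      n³≡∑∑∑1 = sym (begin-equality
        ∑[ x < n ] ∑[ i < n ] ∑[ j < n ] 1  ≡⟨ sum-cong-≗ {n} (λ _ → sum-cong-≗ {n} (λ _ → ∑-const n 1)) ⟩
        ∑[ x < n ] ∑[ i < n ] (n * 1)      ≡⟨ sum-cong-≗ {n} (λ _ → ∑-const n (n * 1)) ⟩
        ∑[ x < n ] (n * (n * 1))           ≡⟨ ∑-const n (n * (n * 1)) ⟩
        n * (n * (n * 1))                  ∎)

-- With s = 2k²R and M = kn, the contribution R·n·M² is exactly half of s·n³.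
n≤8k³R² : ∀ k R n .{{_ : NonZero k}} .{{_ : NonZero R}} .{{_ : NonZero n}} →
  let s = 2 * k * k * R; M = k * n in
  s * (n * (n * (n * 1))) ≤ R * (n * (s * s * (M + M) + M * M)) → n ≤ 8 * k * k * k * (R * R)
n≤8k³R² k R n bound = *-cancelʳ-≤ n (8 * k * k * k * (R * R)) n (*-cancelˡ-≤ u u*n²≤u*8k³R²n)
  where
  u = k * k * R * n
  instance
    u≢0 : NonZero u
    u≢0 = m*n≢0 (k * k * R) n {{m*n≢0 (k * k) R {{m*n≢0 k k}}}}
  lhs : ∀ k R n → 2 * k * k * R * (n * (n * (n * 1))) ≡ k * k * R * n * (n * n) + k * k * R * n * (n * n)
  lhs = solve-∀
  rhs : ∀ k R n → R * (n * (2 * k * k * R * (2 * k * k * R) * (k * n + k * n) + k * n * (k * n)))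
                  ≡ k * k * R * n * (8 * k * k * k * (R * R) * n) + k * k * R * n * (n * n)
  rhs = solve-∀
  u*n²≤u*8k³R²n : u * (n * n) ≤ u * (8 * k * k * k * (R * R) * n)
  u*n²≤u*8k³R²n = +-cancelʳ-≤ (u * (n * n)) _ _ (subst₂ _≤_ (lhs k R n) (rhs k R n) bound)

theorem3 : (k : ℕ) → ∃[ α ] ∃[ N ] ((n : ℕ) → N ≤ n → (R : ℕ) → (E : Execution n (k * n)) → MultipliesIn E R → n ≤ α * (R * R))
theorem3 k = 8 * k * k * k , 0 , λ n _ R E multiplies → rounds-lower-bound k n R E multiplies
  where
  rounds-lower-bound : ∀ k n R (E : Execution n (k * n)) → MultipliesIn E R → n ≤ 8 * k * k * k * (R * R)
  rounds-lower-bound k zero R E _ = z≤n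
  rounds-lower-bound zero (suc n) R E _ with input-a E zero zero
  ... | p , a∈mem = ⊥-elim (<⇒≱ (∈-length a∈mem) (mem-bound E 0 p))
  rounds-lower-bound (suc k) (suc n) zero E multiplies with multiplies zero zero zero
  ... | _ , () , _
  rounds-lower-bound (suc k) (suc n) (suc R) E multiplies =
    n≤8k³R² (suc k) (suc R) (suc n) (s*n³≤ E multiplies (2 * suc k * suc k * suc R))
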